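{- Let $p$ be a prime and let $A,B$ be distinct nonzero integers, neither divisible by $p$. Consider the equation $$Ap^{X_1}-Ap^{X_2}+Bp^{X_3}-Bp^{X_4}=0,\qquad X_1,\ldots,X_4\in\mathbb{Z}_{\ge0}.$$ Then there is a set $\mathscr{D}\subset\mathbb{Z}$ (depending on $p,A,B$) with $|\mathscr{D}|\le\exp(4\times18^9)+1$ such that every solution $(x_1,x_2,x_3,x_4)$ satisfies $(x_3-x_4)-(x_1-x_2)\in\mathscr{D}$. -}

module Defs where

open import Data.Nat using (ℕ; zero; suc; _+_; _*_; _^_; _≤_; _!)
open import Data.Product using (∃-syntax)

-- expScaled N m  =  m! * Σ_{j=0}^{m} N^j / j!   =  Σ_{j=0}^{m} N^j * (m!/j!)
-- (an exact natural number: the m-th Taylor partial sum of exp N, scaled by m!)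
expScaled : ℕ → ℕ → ℕ
expScaled N zero    = 1
expScaled N (suc m) = suc m * expScaled N m + N ^ suc m

-- k ≤exp N  means  (k : ℝ) ≤ exp(N).
-- Since the partial sums Σ_{j≤m} N^j/j! increase to exp(N), and exp(N) is
-- irrational for N > 0 (and exp 0 = 1 = its 0-th partial sum), we have
-- k ≤ exp(N)  iff  k ≤ Σ_{j≤m} N^j/j! for some m  iff  k * m! ≤ expScaled N m.
_≤exp_ : ℕ → ℕ → Set
k ≤exp N = ∃[ m ] (k * m ! ≤ expScaled N m)

{-# OPTIONS --safe #-}
module Submission where

-- By the symmetry (x₁,x₂,x₃,x₄) ↦ (x₂,x₁,x₄,x₃), which negates the gap (x₃ − x₄) − (x₁ − x₂),
-- assume x₂ < x₁ and write x₁ = x₂ + a; then x₃ ≠ x₄, and with {x₃,x₄} = {n, n + b} the equation reads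
-- p^x₂ A (pᵃ − 1) = ± p^n B (pᵇ − 1). Both cofactors are prime to p, so x₂ = n and
-- A (pᵃ − 1) = ± B (pᵇ − 1), making the gap b − a or −(a + b). For a < b this says
-- pᵃ (A ∓ B p^(b−a)) = A ∓ B with the bracket prime to p, so its valuation fixes a and then its
-- value fixes b − a; a > b is symmetric, and a = b gives gap 0 (it would force A = B in the
-- other sign). Hence at most ten gaps occur.

open import Defs
open import Data.Nat using (ℕ; _∸_)
import Data.Nat
open import Data.Nat.Primality using (Prime)
open import Data.Integer using (ℤ; +_; _+_; _-_; _*_; _^_)
open import Data.Integer.Divisibility using (_∣_)
open import Data.List using (List; length)
open import Data.List.Membership.Propositional using (_∈_)
open import Data.Product using (Σ-syntax; _×_)
open import Relation.Binary.PropositionalEquality using (_≡_; _≢_)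
open import Relation.Nullary using (¬_)

open import Data.Nat.Base as ℕ
  using (suc; zero; _<_; _≤_; z≤n; s≤s; compare; less; equal; greater)
import Data.Nat.Properties as ℕ
open import Data.Nat.Primality using (euclidsLemma; prime⇒nonZero; prime⇒nonTrivial)
import Data.Nat.Divisibility as ℕ
open import Data.Integer.Base as ℤ using (-_; 0ℤ; 1ℤ; ∣_∣)
import Data.Integer.Properties as ℤ
open import Data.Integer.Divisibility.Signed
  using (divides; ∣⇒∣ᵤ; ∣ᵤ⇒∣; ∣m⇒∣-m; ∣m⇒∣m*n; ∣n⇒∣m*n; ∣m+n∣m⇒∣n; ∣m+n∣n⇒∣m)
  renaming (_∣_ to _∣ₛ_)
open import Data.Integer.Tactic.RingSolver using (solve-∀)
open import Data.Fin.Base using (toℕ; fromℕ<)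
open import Data.Fin.Properties using (any?; toℕ-fromℕ<)
open import Data.List using ([]; _∷_; _++_; map)
open import Data.List.Relation.Unary.Any using (here; there)
open import Data.List.Membership.Propositional.Properties using (∈-map⁺; ∈-++⁺ˡ; ∈-++⁺ʳ)
open import Data.Product using (∃-syntax; _,_; proj₁; proj₂; swap)
open import Data.Sum using (_⊎_; inj₁; inj₂; [_,_]′)
import Data.Sum as Sum
open import Function using (_∘_; flip)
open import Relation.Binary.PropositionalEquality
  using (refl; sym; trans; cong; cong₂; subst; subst₂; module ≡-Reasoning)
open import Relation.Nullary using (yes; no; contradiction)
open import Relation.Nullary.Decidable using (toWitness)
open import Relation.Unary using (Decidable)

Determined : {A : Set} → (A → Set) → Set
Determined {A} Q = Σ[ x₀ ∈ A ] (∀ {x} → Q x → x ≡ x₀)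

bounded-unique⇒determined : {Q : ℕ × ℕ → Set} (K : ℕ) → Decidable Q
  → (∀ {i k} → Q (i , k) → i < K × k < K)
  → (∀ {x y} → Q x → Q y → x ≡ y)
  → Determined Q
bounded-unique⇒determined {Q} K Q? bounded unique
  with any? (λ i → any? (λ k → Q? (toℕ i , toℕ k)))
... | yes (i , k , q) = (toℕ i , toℕ k) , λ q′ → unique q′ q
... | no noneInBox = (0 , 0) , λ q → contradiction (inBox q) noneInBox
  where
    inBox : ∀ {i k} → Q (i , k) → ∃[ i′ ] ∃[ k′ ] Q (toℕ i′ , toℕ k′)
    inBox q with i<K , k<K ← bounded q =
      fromℕ< i<K , fromℕ< k<K ,
      subst Q (sym (cong₂ _,_ (toℕ-fromℕ< i<K) (toℕ-fromℕ< k<K))) q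

-- The witness is the partial sum 1 + N of the exponential series.
≤1+⇒≤exp : ∀ {k N} → k ≤ suc N → k ≤exp N
≤1+⇒≤exp {k} {N} k≤1+N =
  1 , subst₂ _≤_ (sym (ℕ.*-identityʳ k)) (cong suc (sym (ℕ.*-identityʳ N))) k≤1+N

OffDiagonalWithin : (ℕ → ℕ → Set) → List (ℕ × ℕ) → Set
OffDiagonalWithin R U = ∀ a b → R a b → a ≡ b ⊎ (a , b) ∈ U

-≢0 : ∀ {i} → i ≢ 0ℤ → - i ≢ 0ℤ
-≢0 {i} i≢0 -i≡0 = i≢0 (trans (sym (ℤ.neg-involutive i)) (cong -_ -i≡0))

gap : ℕ → ℕ → ℕ → ℕ → ℤ
gap x₁ x₂ x₃ x₄ = (+ x₃ - + x₄) - (+ x₁ - + x₂)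

diff : ℕ × ℕ → ℤ
diff (a , b) = + b - + a

negSum : ℕ × ℕ → ℤ
negSum (a , b) = - + b - + a

gaps : List (ℕ × ℕ) → List (ℕ × ℕ) → List ℤ
gaps U V = 0ℤ ∷ map diff U ++ map negSum V

+[1+m+k]-+m≡+[1+k] : ∀ m k → + suc (m ℕ.+ k) - + m ≡ + suc k
+[1+m+k]-+m≡+[1+k] m k = begin
  + suc (m ℕ.+ k) - + m          ≡⟨ cong (_- + m) (ℤ.pos-+ 1 (m ℕ.+ k)) ⟩
  1ℤ + + (m ℕ.+ k) - + m         ≡⟨ cong (λ t → 1ℤ + t - + m) (ℤ.pos-+ m k) ⟩
  1ℤ + (+ m + + k) - + m         ≡⟨ cancel (+ m) (+ k) ⟩
  1ℤ + + k                       ≡⟨ ℤ.pos-+ 1 k ⟨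
  + suc k                        ∎
  where
    open ≡-Reasoning
    cancel : ∀ m k → 1ℤ + (m + k) - m ≡ 1ℤ + k
    cancel = solve-∀

gap-ascending : ∀ m a n b → gap (suc (m ℕ.+ a)) m (suc (n ℕ.+ b)) n ≡ diff (suc a , suc b)
gap-ascending m a n b = cong₂ _-_ (+[1+m+k]-+m≡+[1+k] n b) (+[1+m+k]-+m≡+[1+k] m a)

gap-descending : ∀ m a n b → gap (suc (m ℕ.+ a)) m n (suc (n ℕ.+ b)) ≡ negSum (suc a , suc b)
gap-descending m a n b =
  cong₂ _-_ (trans (i-j≡-[j-i] (+ n) (+ suc (n ℕ.+ b))) (cong -_ (+[1+m+k]-+m≡+[1+k] n b)))
            (+[1+m+k]-+m≡+[1+k] m a)
  where
    i-j≡-[j-i] : ∀ i j → i - j ≡ - (j - i)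
    i-j≡-[j-i] = solve-∀

gap-swap : ∀ x₁ x₂ x₃ x₄ → gap x₁ x₂ x₃ x₄ ≡ - gap x₂ x₁ x₄ x₃
gap-swap x₁ x₂ x₃ x₄ = swap-ℤ (+ x₁) (+ x₂) (+ x₃) (+ x₄)
  where
    swap-ℤ : ∀ x₁ x₂ x₃ x₄ → (x₃ - x₄) - (x₁ - x₂) ≡ - ((x₄ - x₃) - (x₂ - x₁))
    swap-ℤ = solve-∀

gap-diagonal : ∀ x y → gap x x y y ≡ 0ℤ
gap-diagonal x y = diagonal (+ x) (+ y)
  where
    diagonal : ∀ x y → (y - y) - (x - x) ≡ 0ℤ
    diagonal = solve-∀

module _ {p : ℕ} (prime : Prime p) where

  private
    P : ℤ
    P = + p

    instance
      p-nonZero : ℕ.NonZero p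
      p-nonZero = prime⇒nonZero prime

    1<p : 1 < p
    1<p = ℕ.nonTrivial⇒n>1 p {{prime⇒nonTrivial prime}}

  n<p^n : ∀ n → n < p ℕ.^ n
  n<p^n zero    = s≤s z≤n
  n<p^n (suc n) = ℕ.≤-<-trans (n<p^n n) (ℕ.^-monoʳ-< p 1<p (ℕ.n<1+n n))

  ∣P^n*X∣≡p^n*∣X∣ : ∀ n X → ∣ P ^ n * X ∣ ≡ p ℕ.^ n ℕ.* ∣ X ∣
  ∣P^n*X∣≡p^n*∣X∣ zero    X = trans (cong ∣_∣ (ℤ.*-identityˡ X)) (sym (ℕ.*-identityˡ ∣ X ∣))
  ∣P^n*X∣≡p^n*∣X∣ (suc n) X = begin
    ∣ P * P ^ n * X ∣          ≡⟨ cong ∣_∣ (ℤ.*-assoc P (P ^ n) X) ⟩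
    ∣ P * (P ^ n * X) ∣        ≡⟨ ℤ.abs-* P (P ^ n * X) ⟩
    p ℕ.* ∣ P ^ n * X ∣        ≡⟨ cong (p ℕ.*_) (∣P^n*X∣≡p^n*∣X∣ n X) ⟩
    p ℕ.* (p ℕ.^ n ℕ.* ∣ X ∣)  ≡⟨ ℕ.*-assoc p (p ℕ.^ n) ∣ X ∣ ⟨
    p ℕ.^ suc n ℕ.* ∣ X ∣      ∎
    where open ≡-Reasoning

  ∣X∣≤∣P^n*X∣ : ∀ n X → ∣ X ∣ ≤ ∣ P ^ n * X ∣
  ∣X∣≤∣P^n*X∣ n X rewrite ∣P^n*X∣≡p^n*∣X∣ n X =
    ℕ.m≤n*m ∣ X ∣ (p ℕ.^ n) {{ℕ.m^n≢0 p n}}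

  n<∣P^n*X∣ : ∀ n {X} → X ≢ 0ℤ → n < ∣ P ^ n * X ∣
  n<∣P^n*X∣ n {X} X≢0 rewrite ∣P^n*X∣≡p^n*∣X∣ n X =
    ℕ.<-≤-trans (n<p^n n) (ℕ.m≤m*n (p ℕ.^ n) ∣ X ∣ {{ℤ.≢-nonZero X≢0}})

  P∤1 : ¬ P ∣ₛ 1ℤ
  P∤1 P∣1 = ℕ.<⇒≢ 1<p (sym (ℕ.∣1⇒≡1 (∣⇒∣ᵤ P∣1)))

  P∣P^[1+n] : ∀ n → P ∣ₛ P ^ suc n
  P∣P^[1+n] n = divides (P ^ n) (ℤ.*-comm P (P ^ n))

  P∤P^[1+n]-1 : ∀ n → ¬ P ∣ₛ P ^ suc n - 1ℤ
  P∤P^[1+n]-1 n P∣ = P∤1 (∣m⇒∣-m (∣m+n∣m⇒∣n P∣ (P∣P^[1+n] n)))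

  P∤X⇒P∤-X : ∀ {X} → ¬ P ∣ₛ X → ¬ P ∣ₛ - X
  P∤X⇒P∤-X {X} P∤X P∣-X = P∤X (subst (P ∣ₛ_) (ℤ.neg-involutive X) (∣m⇒∣-m P∣-X))

  P∣X*Y⇒P∣X⊎P∣Y : ∀ {X Y} → P ∣ₛ X * Y → P ∣ₛ X ⊎ P ∣ₛ Y
  P∣X*Y⇒P∣X⊎P∣Y {X} {Y} P∣XY = Sum.map ∣ᵤ⇒∣ ∣ᵤ⇒∣
    (euclidsLemma ∣ X ∣ ∣ Y ∣ prime (subst (p ℕ.∣_) (ℤ.abs-* X Y) (∣⇒∣ᵤ P∣XY)))

  P∤X⇒P∤X*[P^[1+n]-1] : ∀ {X} n → ¬ P ∣ₛ X → ¬ P ∣ₛ X * (P ^ suc n - 1ℤ)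
  P∤X⇒P∤X*[P^[1+n]-1] n P∤X = [ P∤X , P∤P^[1+n]-1 n ]′ ∘ P∣X*Y⇒P∣X⊎P∣Y

  P∤C⇒P∤C+E*P^[1+k] : ∀ {C} E k → ¬ P ∣ₛ C → ¬ P ∣ₛ C + E * P ^ suc k
  P∤C⇒P∤C+E*P^[1+k] E k P∤C P∣ = P∤C (∣m+n∣n⇒∣m P∣ (∣n⇒∣m*n E (P∣P^[1+n] k)))

  P^m*X≡P^n*Y⇒m≡n : ∀ m n {X Y} → ¬ P ∣ₛ X → ¬ P ∣ₛ Y → P ^ m * X ≡ P ^ n * Y → m ≡ n
  P^m*X≡P^n*Y⇒m≡n zero    zero    _   _   _ = refl
  P^m*X≡P^n*Y⇒m≡n zero    (suc n) {X} {Y} P∤X _ e =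
    contradiction (subst (P ∣ₛ_) (trans (sym e) (ℤ.*-identityˡ X)) (∣m⇒∣m*n Y (P∣P^[1+n] n))) P∤X
  P^m*X≡P^n*Y⇒m≡n (suc m) zero    {X} {Y} _ P∤Y e =
    contradiction (subst (P ∣ₛ_) (trans e (ℤ.*-identityˡ Y)) (∣m⇒∣m*n X (P∣P^[1+n] m))) P∤Y
  P^m*X≡P^n*Y⇒m≡n (suc m) (suc n) {X} {Y} P∤X P∤Y e =
    cong suc (P^m*X≡P^n*Y⇒m≡n m n P∤X P∤Y (ℤ.*-cancelˡ-≡ P _ _ (begin
      P * (P ^ m * X)  ≡⟨ ℤ.*-assoc P (P ^ m) X ⟨
      P ^ suc m * X    ≡⟨ e ⟩
      P ^ suc n * Y    ≡⟨ ℤ.*-assoc P (P ^ n) Y ⟩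
      P * (P ^ n * Y)  ∎)))
    where open ≡-Reasoning

  P^m*X≡P^n*Y⇒X≡Y : ∀ m n {X Y} → ¬ P ∣ₛ X → ¬ P ∣ₛ Y → P ^ m * X ≡ P ^ n * Y → X ≡ Y
  P^m*X≡P^n*Y⇒X≡Y m n P∤X P∤Y e with refl ← P^m*X≡P^n*Y⇒m≡n m n P∤X P∤Y e =
    ℤ.*-cancelˡ-≡ (P ^ m) _ _ {{ℤ.≢-nonZero P^m≢0}} e
    where
      P^m≢0 : P ^ m ≢ 0ℤ
      P^m≢0 = ℕ.≢-nonZero⁻¹ p ∘ ℤ.+-injective ∘ ℤ.i^n≡0⇒i≡0 P m

  ^-injective : ∀ m n → P ^ m ≡ P ^ n → m ≡ n
  ^-injective m n e = P^m*X≡P^n*Y⇒m≡n m n P∤1 P∤1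
    (trans (ℤ.*-identityʳ (P ^ m)) (trans e (sym (ℤ.*-identityʳ (P ^ n)))))

  ExpEq : ℤ → ℤ → ℤ → ℕ × ℕ → Set
  ExpEq C E F (i , k) = P ^ i * (C + E * P ^ suc k) ≡ F

  module _ {C E F : ℤ} (P∤C : ¬ P ∣ₛ C) (E≢0 : E ≢ 0ℤ) where

    ExpEq-unique : ∀ {x y} → ExpEq C E F x → ExpEq C E F y → x ≡ y
    ExpEq-unique {i , k} {j , l} e e′ =
      cong₂ _,_ i≡j (ℕ.suc-injective (^-injective (suc k) (suc l) powers))
      where
        P∤C+ : ∀ k → ¬ P ∣ₛ C + E * P ^ suc k
        P∤C+ k = P∤C⇒P∤C+E*P^[1+k] E k P∤C
        same : P ^ i * (C + E * P ^ suc k) ≡ P ^ j * (C + E * P ^ suc l)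
        same = trans e (sym e′)
        i≡j : i ≡ j
        i≡j = P^m*X≡P^n*Y⇒m≡n i j (P∤C+ k) (P∤C+ l) same
        +-cancelˡ : ∀ X Y → C + X ≡ C + Y → X ≡ Y
        +-cancelˡ X Y eq = trans (minusC C X) (trans (cong (_- C) eq) (sym (minusC C Y)))
          where
            minusC : ∀ C X → X ≡ (C + X) - C
            minusC = solve-∀
        powers : P ^ suc k ≡ P ^ suc l
        powers = ℤ.*-cancelˡ-≡ E _ _ {{ℤ.≢-nonZero E≢0}}
          (+-cancelˡ _ _ (P^m*X≡P^n*Y⇒X≡Y i j (P∤C+ k) (P∤C+ l) same))

    ExpEq-bounded : ∀ {i k} → ExpEq C E F (i , k)
      → i < ∣ F ∣ ℕ.+ ∣ C ∣ × k < ∣ F ∣ ℕ.+ ∣ C ∣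
    ExpEq-bounded {i} {k} refl = ℕ.<-≤-trans i<∣F∣ (ℕ.m≤m+n _ _) , k<∣F∣+∣C∣
      where
        X = C + E * P ^ suc k
        X≢0 : X ≢ 0ℤ
        X≢0 X≡0 = P∤C⇒P∤C+E*P^[1+k] E k P∤C (subst (P ∣ₛ_) (sym X≡0) (divides 0ℤ refl))
        i<∣F∣ : i < ∣ P ^ i * X ∣
        i<∣F∣ = n<∣P^n*X∣ i X≢0
        k<∣F∣+∣C∣ : k < ∣ P ^ i * X ∣ ℕ.+ ∣ C ∣
        k<∣F∣+∣C∣ = begin-strict
          k                          <⟨ ℕ.n<1+n k ⟩
          suc k                      <⟨ n<∣P^n*X∣ (suc k) E≢0 ⟩
          ∣ P ^ suc k * E ∣          ≡⟨ cong ∣_∣ (peel C E (P ^ suc k)) ⟩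
          ∣ X + - C ∣                ≤⟨ ℤ.∣i+j∣≤∣i∣+∣j∣ X (- C) ⟩
          ∣ X ∣ ℕ.+ ∣ - C ∣          ≡⟨ cong (∣ X ∣ ℕ.+_) (ℤ.∣-i∣≡∣i∣ C) ⟩
          ∣ X ∣ ℕ.+ ∣ C ∣            ≤⟨ ℕ.+-monoˡ-≤ ∣ C ∣ (∣X∣≤∣P^n*X∣ i X) ⟩
          ∣ P ^ i * X ∣ ℕ.+ ∣ C ∣    ∎
          where
            open ℕ.≤-Reasoning
            peel : ∀ C E Q → Q * E ≡ (C + E * Q) + - C
            peel = solve-∀

    ExpEq-determined : Determined (ExpEq C E F)
    ExpEq-determined = bounded-unique⇒determined _
      (λ (i , k) → P ^ i * (C + E * P ^ suc k) ℤ.≟ F) ExpEq-bounded ExpEq-unique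

  RepunitEq : ℤ → ℤ → ℕ → ℕ → Set
  RepunitEq A C a b = A * (P ^ a - 1ℤ) ≡ C * (P ^ b - 1ℤ)

  RepunitEq⇒ExpEq : ∀ {A C} a c → RepunitEq A C a (suc (a ℕ.+ c))
    → ExpEq A (- C) (A - C) (a , c)
  RepunitEq⇒ExpEq {A} {C} a c s = begin
    P ^ a * (A + - C * P ^ suc c)
      ≡⟨ rearrange A C (P ^ a) (P ^ suc c) ⟩
    (A * (P ^ a - 1ℤ) - C * (P ^ a * P ^ suc c - 1ℤ)) + (A - C)
      ≡⟨ cong (λ t → (A * (P ^ a - 1ℤ) - C * (t - 1ℤ)) + (A - C)) P^a*P^[1+c] ⟩
    (A * (P ^ a - 1ℤ) - C * (P ^ suc (a ℕ.+ c) - 1ℤ)) + (A - C)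
      ≡⟨ cong (_+ (A - C)) (ℤ.i≡j⇒i-j≡0 s) ⟩
    0ℤ + (A - C)
      ≡⟨ ℤ.+-identityˡ (A - C) ⟩
    A - C
      ∎
    where
      open ≡-Reasoning
      rearrange : ∀ A C u v → u * (A + - C * v) ≡ (A * (u - 1ℤ) - C * (u * v - 1ℤ)) + (A - C)
      rearrange = solve-∀
      P^a*P^[1+c] : P ^ a * P ^ suc c ≡ P ^ suc (a ℕ.+ c)
      P^a*P^[1+c] = trans (sym (ℤ.^-distribˡ-+-* P a (suc c))) (cong (P ^_) (ℕ.+-suc a c))

  RepunitEq-offDiagonal : ∀ {A C} → ¬ P ∣ₛ A → ¬ P ∣ₛ C → A ≢ 0ℤ → C ≢ 0ℤ
    → Σ[ u ∈ ℕ × ℕ ] Σ[ v ∈ ℕ × ℕ ] OffDiagonalWithin (RepunitEq A C) (u ∷ v ∷ [])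
  RepunitEq-offDiagonal {A} {C} P∤A P∤C A≢0 C≢0 =
    ends (proj₁ below) , swap (ends (proj₁ above)) , classify
    where
      ends : ℕ × ℕ → ℕ × ℕ
      ends (i , k) = i , suc (i ℕ.+ k)
      below : Determined (ExpEq A (- C) (A - C))
      below = ExpEq-determined {F = A - C} P∤A (-≢0 C≢0)
      above : Determined (ExpEq C (- A) (C - A))
      above = ExpEq-determined {F = C - A} P∤C (-≢0 A≢0)
      classify : OffDiagonalWithin (RepunitEq A C)
                   (ends (proj₁ below) ∷ swap (ends (proj₁ above)) ∷ [])
      classify a b s with compare a b
      ... | less .a c    =
        inj₂ (here (cong ends (proj₂ below (RepunitEq⇒ExpEq {A} {C} a c s))))
      ... | equal .a     = inj₁ refl
      ... | greater .b c =
        inj₂ (there (here (cong (swap ∘ ends) (proj₂ above (RepunitEq⇒ExpEq {C} {A} b c (sym s))))))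

  RepunitEq-diagonal : ∀ {A C} a → A ≢ C → ¬ RepunitEq A C (suc a) (suc a)
  RepunitEq-diagonal {A} {C} a A≢C s =
    [ A≢C ∘ ℤ.i-j≡0⇒i≡j A C , ℕ.1+n≢0 ∘ ^-injective (suc a) 0 ∘ ℤ.i-j≡0⇒i≡j _ _ ]′
      (ℤ.i*j≡0⇒i≡0∨j≡0 (A - C) (trans (factor A C (P ^ suc a)) (ℤ.i≡j⇒i-j≡0 s)))
    where
      factor : ∀ A C w → (A - C) * (w - 1ℤ) ≡ A * (w - 1ℤ) - C * (w - 1ℤ)
      factor = solve-∀

  Δ : ℤ → ℕ → ℕ → ℤ
  Δ A x y = A * (P ^ x - P ^ y)

  equation⇒Δ : ∀ {A B} x₁ x₂ x₃ x₄ → A * P ^ x₁ - A * P ^ x₂ + B * P ^ x₃ - B * P ^ x₄ ≡ 0ℤ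
    → Δ A x₁ x₂ ≡ Δ B x₄ x₃
  equation⇒Δ {A} {B} x₁ x₂ x₃ x₄ e =
    ℤ.i-j≡0⇒i≡j _ _ (trans (regroup A B (P ^ x₁) (P ^ x₂) (P ^ x₃) (P ^ x₄)) e)
    where
      regroup : ∀ A B u₁ u₂ u₃ u₄
        → A * (u₁ - u₂) - B * (u₄ - u₃) ≡ A * u₁ - A * u₂ + B * u₃ - B * u₄
      regroup = solve-∀

  Δ-diagonal : ∀ A x → Δ A x x ≡ 0ℤ
  Δ-diagonal A x = trans (cong (A *_) (ℤ.+-inverseʳ (P ^ x))) (ℤ.*-zeroʳ A)

  Δ≡0⇒≡ : ∀ {A} x y → A ≢ 0ℤ → Δ A x y ≡ 0ℤ → x ≡ y
  Δ≡0⇒≡ {A} x y A≢0 e =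
    [ flip contradiction A≢0 , ^-injective x y ∘ ℤ.i-j≡0⇒i≡j _ _ ]′ (ℤ.i*j≡0⇒i≡0∨j≡0 A e)

  Δ-antisym : ∀ A x y → Δ A y x ≡ - Δ A x y
  Δ-antisym A x y = antisym A (P ^ x) (P ^ y)
    where
      antisym : ∀ A u v → A * (v - u) ≡ - (A * (u - v))
      antisym = solve-∀

  Δ-neg : ∀ A x y → Δ A x y ≡ Δ (- A) y x
  Δ-neg A x y = negate A (P ^ x) (P ^ y)
    where
      negate : ∀ A u v → A * (u - v) ≡ - A * (v - u)
      negate = solve-∀

  Δ-factor : ∀ A m a → Δ A (suc (m ℕ.+ a)) m ≡ P ^ m * (A * (P ^ suc a - 1ℤ))
  Δ-factor A m a = begin
    A * (P ^ suc (m ℕ.+ a) - P ^ m)  ≡⟨ cong (λ t → A * (P ^ t - P ^ m)) (ℕ.+-suc m a) ⟨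
    A * (P ^ (m ℕ.+ suc a) - P ^ m)  ≡⟨ cong (λ t → A * (t - P ^ m)) (ℤ.^-distribˡ-+-* P m (suc a)) ⟩
    A * (P ^ m * P ^ suc a - P ^ m)  ≡⟨ factor A (P ^ m) (P ^ suc a) ⟩
    P ^ m * (A * (P ^ suc a - 1ℤ))   ∎
    where
      open ≡-Reasoning
      factor : ∀ A u v → A * (u * v - u) ≡ u * (A * (v - 1ℤ))
      factor = solve-∀

  Δ⇒RepunitEq : ∀ {A C} m n a b → ¬ P ∣ₛ A → ¬ P ∣ₛ C
    → Δ A (suc (m ℕ.+ a)) m ≡ Δ C (suc (n ℕ.+ b)) n → RepunitEq A C (suc a) (suc b)
  Δ⇒RepunitEq {A} {C} m n a b P∤A P∤C e =
    P^m*X≡P^n*Y⇒X≡Y m n (P∤X⇒P∤X*[P^[1+n]-1] a P∤A) (P∤X⇒P∤X*[P^[1+n]-1] b P∤C)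
      (trans (sym (Δ-factor A m a)) (trans e (Δ-factor C n b)))

  module _ {A B : ℤ} (A≢0 : A ≢ 0ℤ) (B≢0 : B ≢ 0ℤ) (A≢B : A ≢ B)
           (P∤A : ¬ P ∣ₛ A) (P∤B : ¬ P ∣ₛ B) {U V : List (ℕ × ℕ)}
           (opposite : OffDiagonalWithin (RepunitEq A (- B)) U)
           (same : OffDiagonalWithin (RepunitEq A B) V) where

    oppositeSigns : ∀ a b → RepunitEq A (- B) a b → diff (a , b) ∈ 0ℤ ∷ map diff U
    oppositeSigns a b s with opposite a b s
    ... | inj₁ refl = here (ℤ.+-inverseʳ (+ a))
    ... | inj₂ ab∈U = there (∈-map⁺ diff ab∈U)

    sameSigns : ∀ a b → RepunitEq A B (suc a) (suc b) → negSum (suc a , suc b) ∈ map negSum V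
    sameSigns a b s with same (suc a) (suc b) s
    ... | inj₁ refl = contradiction s (RepunitEq-diagonal a A≢B)
    ... | inj₂ ab∈V = ∈-map⁺ negSum ab∈V

    gap∈gaps : ∀ m a x₃ x₄ → Δ A (suc (m ℕ.+ a)) m ≡ Δ B x₄ x₃
      → gap (suc (m ℕ.+ a)) m x₃ x₄ ∈ gaps U V
    gap∈gaps m a x₃ x₄ e with compare x₃ x₄
    ... | less n b =
      ∈-++⁺ʳ (0ℤ ∷ map diff U) (subst (_∈ map negSum V) (sym (gap-descending m a n b))
        (sameSigns a b (Δ⇒RepunitEq m n a b P∤A P∤B e)))
    ... | equal n =
      contradiction (Δ≡0⇒≡ (suc (m ℕ.+ a)) m A≢0 (trans e (Δ-diagonal B n)))
        (ℕ.m+1+n≢m m ∘ trans (ℕ.+-suc m a))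
    ... | greater n b =
      ∈-++⁺ˡ (subst (_∈ 0ℤ ∷ map diff U) (sym (gap-ascending m a n b))
        (oppositeSigns (suc a) (suc b)
          (Δ⇒RepunitEq m n a b P∤A (P∤X⇒P∤-X P∤B) (trans e (Δ-neg B n (suc (n ℕ.+ b)))))))

    gap∈±gaps : ∀ x₁ x₂ x₃ x₄ → Δ A x₁ x₂ ≡ Δ B x₄ x₃
      → gap x₁ x₂ x₃ x₄ ∈ gaps U V ++ map -_ (gaps U V)
    gap∈±gaps x₁ x₂ x₃ x₄ e with compare x₁ x₂
    ... | less m a =
      ∈-++⁺ʳ (gaps U V) (subst (_∈ map -_ (gaps U V)) (sym (gap-swap m (suc (m ℕ.+ a)) x₃ x₄))
        (∈-map⁺ -_ (gap∈gaps m a x₄ x₃ swapped)))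
      where
        swapped : Δ A (suc (m ℕ.+ a)) m ≡ Δ B x₃ x₄
        swapped = trans (Δ-antisym A m (suc (m ℕ.+ a)))
                        (trans (cong -_ e) (sym (Δ-antisym B x₄ x₃)))
    ... | equal m with refl ← Δ≡0⇒≡ x₄ x₃ B≢0 (trans (sym e) (Δ-diagonal A m)) =
      ∈-++⁺ˡ {xs = gaps U V} (here (gap-diagonal m x₃))
    ... | greater m a = ∈-++⁺ˡ {xs = gaps U V} (gap∈gaps m a x₃ x₄ e)

lemma3p2 : (p : ℕ) → Prime p → (A B : ℤ) → A ≢ + 0 → B ≢ + 0 → A ≢ B
    → ¬ ((+ p) ∣ A) → ¬ ((+ p) ∣ B)
    → Σ[ D ∈ List ℤ ] ((length D ∸ 1) ≤exp (4 Data.Nat.* 18 Data.Nat.^ 9)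
        × ((x₁ x₂ x₃ x₄ : ℕ)
          → A * (+ p) ^ x₁ - A * (+ p) ^ x₂ + B * (+ p) ^ x₃ - B * (+ p) ^ x₄ ≡ + 0
          → ((+ x₃ - + x₄) - (+ x₁ - + x₂)) ∈ D))
lemma3p2 p isPrime A B A≢0 B≢0 A≢B p∤A p∤B =
  let P∤A = p∤A ∘ ∣⇒∣ᵤ
      P∤B = p∤B ∘ ∣⇒∣ᵤ
      (u , v , opposite) =
        RepunitEq-offDiagonal isPrime P∤A (P∤X⇒P∤-X isPrime P∤B) A≢0 (-≢0 B≢0)
      (u′ , v′ , same) = RepunitEq-offDiagonal isPrime P∤A P∤B A≢0 B≢0
      L = gaps (u ∷ v ∷ []) (u′ ∷ v′ ∷ [])
  in L ++ map -_ L
   , ≤1+⇒≤exp (toWitness {a? = 9 ℕ.≤? _} _)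
   , λ x₁ x₂ x₃ x₄ e →
       gap∈±gaps isPrime A≢0 B≢0 A≢B P∤A P∤B opposite same x₁ x₂ x₃ x₄
         (equation⇒Δ isPrime {A} {B} x₁ x₂ x₃ x₄ e)
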